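{- Let $(a_0:\ldots:a_d)$ be a difference cycle of dimension $d$ on $n$ vertices. Let $k$ be the smallest integer with $1\le k\le d+1$ such that $k\mid(d+1)$ and $a_i=a_{i+k}$ for all $0\le i\le d-k$. Then the length of $(a_0:\ldots:a_d)$ is $\sum_{i=0}^{k-1}a_i=\frac{nk}{d+1}$.
   Context: For positive integers $a_0,\ldots,a_d$ with $n=\sum_{i=0}^d a_i$, the difference cycle $(a_0:\ldots:a_d)$ of dimension $d$ on $n$ vertices is the simplicial complex $\mathbb{Z}_n\langle 0,a_0,a_0+a_1,\ldots,\sum_{i=0}^{d-1}a_i\rangle$. This is the orbit of the $d$-simplex with vertices $0,a_0,\ldots,\sum_{i=0}^{d-1}a_i\in\mathbb{Z}_n$ under the cyclic group generated by $v\mapsto v+1\bmod n$. The length of a difference cycle is the number of its elements, i.e. the number of $d$-simplices in this orbit. -}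

module Defs where

open import Data.Nat using (ℕ; zero; suc; _+_; _*_; _≤_; _%_; NonZero)
open import Data.Nat.Divisibility using (_∣_)
open import Data.Bool using (Bool)
open import Data.Bool.Properties renaming (_≟_ to _≟ᵇ_)
open import Data.Fin using (Fin; toℕ)
open import Data.Vec using (Vec; tabulate)
open import Data.Vec.Properties using (≡-dec)
open import Data.List using (List; upTo; map; deduplicate; length)
open import Data.Bool.ListAction using (any)
open import Data.Product using (_×_)
open import Relation.Nullary.Decidable using (⌊_⌋)
open import Relation.Binary.PropositionalEquality using (_≡_)
import Data.Nat as N

sumTo : ℕ → (ℕ → ℕ) → ℕ
sumTo zero    f = 0
sumTo (suc m) f = sumTo m f + f m

-- A simplex on the vertex set ℤ_n = {0,…,n-1}, as a subset (characteristic vector).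
Simplex : ℕ → Set
Simplex n = Vec Bool n

-- The translate by j of the base simplex ⟨0, a_0, a_0+a_1, …, Σ_{i<d} a_i⟩ in ℤ_n,
-- i.e. the simplex with vertices (Σ_{l<i} a_l + j) mod n for i = 0,…,d.
-- (The sequence a_0,…,a_d is given as a : ℕ → ℕ; only a 0,…,a d are used.)
translate : (n : ℕ) .{{_ : NonZero n}} (d : ℕ) (a : ℕ → ℕ) (j : ℕ) → Simplex n
translate n d a j =
  tabulate λ (x : Fin n) → any (λ i → ⌊ ((sumTo i a + j) % n) N.≟ toℕ x ⌋) (upTo (suc d))

-- The difference cycle (a_0:…:a_d): the orbit of the base simplex under v ↦ v+1 mod n,
-- listed as all translates by j = 0,…,n-1 (with repetitions).
orbitList : (n : ℕ) .{{_ : NonZero n}} (d : ℕ) (a : ℕ → ℕ) → List (Simplex n)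
orbitList n d a = map (translate n d a) (upTo n)

cycleLength : (n : ℕ) .{{_ : NonZero n}} (d : ℕ) (a : ℕ → ℕ) → ℕ
cycleLength n d a = length (deduplicate (≡-dec _≟ᵇ_) (orbitList n d a))

Periodic : (d : ℕ) (a : ℕ → ℕ) (k : ℕ) → Set
Periodic d a k = ∀ i → i + k ≤ d → a i ≡ a (i + k)

Admissible : (d : ℕ) (a : ℕ → ℕ) (k : ℕ) → Set
Admissible d a k = (1 ≤ k) × (k ≤ suc d) × (k ∣ suc d) × Periodic d a k

IsSmallestAdmissible : (d : ℕ) (a : ℕ → ℕ) (k : ℕ) → Set
IsSmallestAdmissible d a k = Admissible d a k × (∀ k′ → Admissible d a k′ → k ≤ k′)

-- Write s i = a_0 + ... + a_(i-1); the base simplex has vertices s 0 < ... < s d in Z_n, and the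
-- translates by t and t + u coincide iff u is a period of this vertex set.  Periodicity of a makes
-- L = s k a period.  Conversely, a period u = s j forces a to be j-periodic, and the remainder r of
-- d+1 modulo j makes s r a smaller period; by descent some admissible j has s j <= u, so L <= u.
-- Hence the orbit consists of exactly the L distinct translates by 0, ..., L-1, and n = ((d+1)/k) L.
module Submission where

open import Data.Bool using (Bool; T)
open import Data.Bool.Properties using (T-≡; ⇔→≡) renaming (_≟_ to _≟ᵇ_)
open import Data.Bool.ListAction using (any)
open import Data.Fin using (Fin; toℕ; fromℕ<)
open import Data.Fin.Properties using (toℕ-fromℕ<; toℕ<n)
open import Data.List using (List; upTo; applyUpTo; deduplicate; length)
open import Data.List.Properties using (length-applyUpTo)
open import Data.List.Membership.Propositional using (_∈_; find; lose)
open import Data.List.Membership.Propositional.Properties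
  using (∈-upTo⁺; ∈-upTo⁻; ∈-applyUpTo⁺; ∈-applyUpTo⁻; ∈-map⁺; ∈-map⁻; deduplicate-∈⇔)
open import Data.List.Membership.Propositional.Properties.WithK using (unique∧set⇒bag)
open import Data.List.Relation.Binary.BagAndSetEquality using (∼bag⇒↭)
open import Data.List.Relation.Binary.Permutation.Propositional.Properties using (↭-length)
open import Data.List.Relation.Unary.Any.Properties using (any⁺; any⁻)
open import Data.List.Relation.Unary.Unique.Propositional using (Unique)
open import Data.List.Relation.Unary.Unique.Propositional.Properties using (applyUpTo⁺₁)
open import Data.List.Relation.Unary.Unique.DecPropositional.Properties using (deduplicate-!)
open import Data.Nat
open import Data.Nat.DivMod
open import Data.Nat.Divisibility using (_∣_; divides; ∣-refl; ∣m+n∣m⇒∣n; m%n≡0⇒n∣m)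
open import Data.Nat.Induction using (<-rec)
open import Data.Nat.Properties
open import Algebra.Properties.CommutativeSemigroup +-commutativeSemigroup using (xy∙z≈xz∙y; xy∙z≈y∙zx)
open import Data.Product using (_×_; _,_; ∃-syntax)
open import Data.Sum using (inj₁; inj₂)
open import Data.Vec using (Vec; lookup)
open import Data.Vec.Properties using (≡-dec; tabulate-cong; tabulate∘lookup; lookup∘tabulate)
open import Function.Bundles using (_⇔_; mk⇔; Equivalence)
open import Function.Properties.Equivalence using ()
  renaming (refl to ⇔-refl; sym to ⇔-sym; trans to ⇔-trans)
open import Relation.Binary.Definitions using (DecidableEquality)
open import Relation.Binary.PropositionalEquality
open import Relation.Nullary using (yes; no; contradiction)
open import Relation.Nullary.Decidable using (toWitness; fromWitness)

open import Defs

length-deduplicate : {A : Set} (_≟_ : DecidableEquality A) (xs ys : List A) → Unique ys →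
                     (∀ {z} → z ∈ xs ⇔ z ∈ ys) → length (deduplicate _≟_ xs) ≡ length ys
length-deduplicate _≟_ xs ys ys-unique xs⇔ys =
  ↭-length (∼bag⇒↭ (unique∧set⇒bag (deduplicate-! _≟_ xs) ys-unique
    (⇔-trans (⇔-sym (deduplicate-∈⇔ _≟_)) xs⇔ys)))

T-⇔⇒≡ : {b c : Bool} → T b ⇔ T c → b ≡ c
T-⇔⇒≡ b⇔c = ⇔→≡ (⇔-trans (⇔-sym T-≡) (⇔-trans b⇔c T-≡))

T-any-upTo : (p : ℕ → Bool) (m : ℕ) → T (any p (upTo m)) ⇔ (∃[ i ] i < m × T (p i))
T-any-upTo p m = mk⇔ to from
  where
  to : T (any p (upTo m)) → ∃[ i ] i < m × T (p i)
  to t with i , i∈ , pi ← find (any⁻ p (upTo m) t) = i , ∈-upTo⁻ i∈ , pi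
  from : ∃[ i ] i < m × T (p i) → T (any p (upTo m))
  from (i , i<m , pi) = any⁺ p (lose (∈-upTo⁺ i<m) pi)

lookup-ext : {A : Set} {m : ℕ} {v w : Vec A m} → (∀ x → lookup v x ≡ lookup w x) → v ≡ w
lookup-ext {v = v} {w} v≗w =
  trans (sym (tabulate∘lookup v)) (trans (tabulate-cong v≗w) (tabulate∘lookup w))

module Congruence (n : ℕ) .{{_ : NonZero n}} where

  infix 4 _≋_
  _≋_ : ℕ → ℕ → Set
  x ≋ y = x % n ≡ y % n

  ≋-+ : ∀ {x x′ y y′} → x ≋ x′ → y ≋ y′ → x + y ≋ x′ + y′
  ≋-+ {x} {x′} {y} {y′} x≋x′ y≋y′ = begin
    (x + y) % n            ≡⟨ %-distribˡ-+ x y n ⟩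
    (x % n + y % n) % n    ≡⟨ cong₂ (λ u v → (u + v) % n) x≋x′ y≋y′ ⟩
    (x′ % n + y′ % n) % n  ≡⟨ %-distribˡ-+ x′ y′ n ⟨
    (x′ + y′) % n          ∎
    where open ≡-Reasoning

  +-inverse : ∀ x c → x + c * pred n + c ≋ x
  +-inverse x c = begin
    (x + c * pred n + c) % n    ≡⟨ cong (_% n) (+-assoc x (c * pred n) c) ⟩
    (x + (c * pred n + c)) % n  ≡⟨ cong (λ m → (x + m) % n) (trans (*-suc c _) (+-comm c (c * pred n))) ⟨
    (x + c * suc (pred n)) % n  ≡⟨ cong (λ m → (x + c * m) % n) (suc-pred n) ⟩
    (x + c * n) % n             ≡⟨ [m+kn]%n≡m%n x c n ⟩
    x % n                       ∎
    where open ≡-Reasoning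

  ≋-cancelʳ : ∀ c {x y} → x + c ≋ y + c → x ≋ y
  ≋-cancelʳ c {x} {y} x+c≋y+c = begin
    x % n                    ≡⟨ +-inverse x c ⟨
    (x + c * pred n + c) % n ≡⟨ cong (_% n) (xy∙z≈xz∙y x (c * pred n) c) ⟩
    (x + c + c * pred n) % n ≡⟨ ≋-+ {y = c * pred n} {c * pred n} x+c≋y+c refl ⟩
    (y + c + c * pred n) % n ≡⟨ cong (_% n) (xy∙z≈xz∙y y c (c * pred n)) ⟩
    (y + c * pred n + c) % n ≡⟨ +-inverse y c ⟩
    y % n                    ∎
    where open ≡-Reasoning

  x+n≋x : ∀ x → x + n ≋ x
  x+n≋x x = [m+n]%n≡m%n x n

  ≋⇒≡ : ∀ {x y} → x < n → y < n → x ≋ y → x ≡ y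
  ≋⇒≡ x<n y<n x≋y = trans (sym (m<n⇒m%n≡m x<n)) (trans x≋y (m<n⇒m%n≡m y<n))

module DifferenceCycle (d : ℕ) (a : ℕ → ℕ) where

  s : ℕ → ℕ
  s i = sumTo i a

  0<sumTo⇒0<index : ∀ {j} → 0 < s j → 0 < j
  0<sumTo⇒0<index {suc _} _ = z<s

  module _ {p : ℕ} (p-periodic : Periodic d a p) where

    a-periodic : ∀ q j → q * p + j ≤ d → a (q * p + j) ≡ a j
    a-periodic zero    j _  = refl
    a-periodic (suc q) j le = begin
      a (suc q * p + j)  ≡⟨ cong a shuffle ⟩
      a (q * p + j + p)  ≡⟨ p-periodic (q * p + j) le′ ⟨
      a (q * p + j)      ≡⟨ a-periodic q j (≤-trans (m≤m+n _ p) le′) ⟩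
      a j                ∎
      where
      open ≡-Reasoning
      shuffle : suc q * p + j ≡ q * p + j + p
      shuffle = trans (+-assoc p (q * p) j) (+-comm p (q * p + j))
      le′ : q * p + j + p ≤ d
      le′ = subst (_≤ d) shuffle le

    sumTo-periodic : ∀ q j → q * p + j ≤ suc d → s (q * p + j) ≡ s (q * p) + s j
    sumTo-periodic q zero    _  = trans (cong s (+-identityʳ (q * p))) (sym (+-identityʳ (s (q * p))))
    sumTo-periodic q (suc j) le = begin
      s (q * p + suc j)              ≡⟨ cong s (+-suc (q * p) j) ⟩
      s (q * p + j) + a (q * p + j)  ≡⟨ cong₂ _+_ (sumTo-periodic q j (≤-trans (n≤1+n _) le′))
                                                  (a-periodic q j (s≤s⁻¹ le′)) ⟩
      s (q * p) + s j + a j          ≡⟨ +-assoc (s (q * p)) (s j) (a j) ⟩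
      s (q * p) + s (suc j)          ∎
      where
      open ≡-Reasoning
      le′ : suc (q * p + j) ≤ suc d
      le′ = subst (_≤ suc d) (+-suc (q * p) j) le

    sumTo-+-multiple : ∀ {m} j → p ∣ m → m + j ≤ suc d → s (m + j) ≡ s m + s j
    sumTo-+-multiple j (divides q refl) = sumTo-periodic q j

    sumTo-multiple : ∀ q → q * p ≤ suc d → s (q * p) ≡ q * s p
    sumTo-multiple zero    _  = refl
    sumTo-multiple (suc q) le = begin
      s (p + q * p)    ≡⟨ cong s (+-comm p (q * p)) ⟩
      s (q * p + p)    ≡⟨ sumTo-periodic q p (subst (_≤ suc d) (+-comm p (q * p)) le) ⟩
      s (q * p) + s p  ≡⟨ cong (_+ s p) (sumTo-multiple q (≤-trans (m≤n+m (q * p) p) le)) ⟩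
      q * s p + s p    ≡⟨ +-comm (q * s p) (s p) ⟩
      suc q * s p      ∎
      where open ≡-Reasoning

  module Translates (n : ℕ) .{{_ : NonZero n}} where

    open Congruence n public

    tr : ℕ → Vec Bool n
    tr t = translate n d a t

    Vertex : ℕ → ℕ → Set
    Vertex t y = ∃[ i ] i ≤ d × s i + t ≋ y

    Vertex-resp : ∀ {t y y′} → y ≋ y′ → Vertex t y → Vertex t y′
    Vertex-resp y≋y′ (i , i≤d , e) = i , i≤d , trans e y≋y′

    Vertex-respᵗ : ∀ {t t′ y} → t ≋ t′ → Vertex t y → Vertex t′ y
    Vertex-respᵗ t≋t′ (i , i≤d , e) = i , i≤d , trans (≋-+ {s i} {s i} refl (sym t≋t′)) e

    Vertex-shift : ∀ c {t y} → Vertex t y → Vertex (t + c) (y + c)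
    Vertex-shift c {t} {y} (i , i≤d , e) =
      i , i≤d , subst (_≋ y + c) (+-assoc (s i) t c) (≋-+ {y = c} {c} e refl)

    Vertex-unshift : ∀ c {t y} → Vertex (t + c) (y + c) → Vertex t y
    Vertex-unshift c {t} {y} (i , i≤d , e) =
      i , i≤d , ≋-cancelʳ c (subst (_≋ y + c) (sym (+-assoc (s i) t c)) e)

    lookup-translate : ∀ t (x : Fin n) → T (lookup (tr t) x) ⇔ Vertex t (toℕ x)
    lookup-translate t x = mk⇔ to from
      where
      x%n≡x : toℕ x % n ≡ toℕ x
      x%n≡x = m<n⇒m%n≡m (toℕ<n x)
      to : T (lookup (tr t) x) → Vertex t (toℕ x)
      to h with i , i<1+d , w ← Equivalence.to (T-any-upTo _ (suc d)) (subst T (lookup∘tabulate _ x) h) =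
        i , s≤s⁻¹ i<1+d , trans (toWitness w) (sym x%n≡x)
      from : Vertex t (toℕ x) → T (lookup (tr t) x)
      from (i , i≤d , e) = subst T (sym (lookup∘tabulate _ x))
        (Equivalence.from (T-any-upTo _ (suc d)) (i , s≤s i≤d , fromWitness (trans e x%n≡x)))

    Agree : ℕ → ℕ → Set
    Agree t t′ = ∀ y → Vertex t y ⇔ Vertex t′ y

    Agree-refl : ∀ {t} → Agree t t
    Agree-refl _ = ⇔-refl

    Agree-sym : ∀ {t t′} → Agree t t′ → Agree t′ t
    Agree-sym h y = ⇔-sym (h y)

    Agree-trans : ∀ {t t′ t″} → Agree t t′ → Agree t′ t″ → Agree t t″
    Agree-trans h h′ y = ⇔-trans (h y) (h′ y)

    Agree-respʳ : ∀ {t t′ t″} → t′ ≋ t″ → Agree t t′ → Agree t t″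
    Agree-respʳ t′≋t″ h y = ⇔-trans (h y) (mk⇔ (Vertex-respᵗ t′≋t″) (Vertex-respᵗ (sym t′≋t″)))

    Agree-shift : ∀ c {t t′} → Agree t t′ → Agree (t + c) (t′ + c)
    Agree-shift c h y = mk⇔ (move h) (move (Agree-sym h))
      where
      y′ = y + c * pred n
      move : ∀ {t t′} → Agree t t′ → Vertex (t + c) y → Vertex (t′ + c) y
      move h v = Vertex-resp (+-inverse y c) (Vertex-shift c (Equivalence.to (h y′)
                   (Vertex-unshift c (Vertex-resp (sym (+-inverse y c)) v))))

    Agree⇒translate-≡ : ∀ {t t′} → Agree t t′ → tr t ≡ tr t′
    Agree⇒translate-≡ {t} {t′} h = lookup-ext λ x →
      T-⇔⇒≡ (⇔-trans (lookup-translate t x) (⇔-trans (h (toℕ x)) (⇔-sym (lookup-translate t′ x))))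

    translate-≡⇒Agree : ∀ {t t′} → tr t ≡ tr t′ → Agree t t′
    translate-≡⇒Agree {t} {t′} eq y =
      ⇔-trans (to-residue t) (⇔-trans (subst (λ v → T (lookup (tr t) x) ⇔ T (lookup v x)) eq ⇔-refl)
                                      (⇔-sym (to-residue t′)))
      where
      x = fromℕ< (m%n<n y n)
      y≋x : y ≋ toℕ x
      y≋x = trans (sym (m%n%n≡m%n y n)) (cong (_% n) (sym (toℕ-fromℕ< (m%n<n y n))))
      to-residue : ∀ t → Vertex t y ⇔ T (lookup (tr t) x)
      to-residue t = ⇔-trans (mk⇔ (Vertex-resp y≋x) (Vertex-resp (sym y≋x))) (⇔-sym (lookup-translate t x))

    IsPeriod : ℕ → Set
    IsPeriod u = Agree 0 u

    period-forward : ∀ {u y} → IsPeriod u → Vertex 0 y → Vertex 0 (y + u)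
    period-forward {u} {y} per v = Equivalence.from (per (y + u)) (Vertex-shift u v)

    period-backward : ∀ {u y} → IsPeriod u → Vertex 0 (y + u) → Vertex 0 y
    period-backward {u} per v = Vertex-unshift u (Equivalence.to (per _) v)

    Agree⇒IsPeriod : ∀ {t u} → Agree t (t + u) → IsPeriod u
    Agree⇒IsPeriod {t} {u} h y = mk⇔
      (λ v → Vertex-unshift t (swap (+-comm t u) (Equivalence.to (h (y + t)) (Vertex-shift t v))))
      (λ v → Vertex-unshift t (Equivalence.from (h (y + t)) (swap (+-comm u t) (Vertex-shift t v))))
      where
      swap : ∀ {t₁ t₂} → t₁ ≡ t₂ → Vertex t₁ (y + t) → Vertex t₂ (y + t)
      swap = subst (λ t′ → Vertex t′ (y + t))

    IsPeriod⇒Agree : ∀ {u} t → IsPeriod u → Agree t (t + u)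
    IsPeriod⇒Agree {u} t per = subst (Agree t) (+-comm u t) (Agree-shift t per)

    IsPeriod-+ : ∀ {u v} → IsPeriod u → IsPeriod v → IsPeriod (u + v)
    IsPeriod-+ {u} {v} pu pv = Agree-trans pv (Agree-shift v pu)

    IsPeriod-* : ∀ {u} q → IsPeriod u → IsPeriod (q * u)
    IsPeriod-* zero    _  = Agree-refl
    IsPeriod-* (suc q) pu = IsPeriod-+ pu (IsPeriod-* q pu)

    IsPeriod-∸ : ∀ {w} → w ≤ n → IsPeriod w → IsPeriod (n ∸ w)
    IsPeriod-∸ {w} w≤n pw =
      Agree-sym (Agree-respʳ (trans (cong (_% n) (m+[n∸m]≡n w≤n)) (x+n≋x 0)) (Agree-shift (n ∸ w) pw))

  module _ (pos : ∀ i → i ≤ d → 1 ≤ a i) where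

    sumTo-step : ∀ {i} → i ≤ d → s i < s (suc i)
    sumTo-step {i} i≤d = m<m+n (s i) (pos i i≤d)

    sumTo-strictMono : ∀ {i j} → i < j → j ≤ suc d → s i < s j
    sumTo-strictMono {i} {suc j} (s≤s i≤j) j<1+d with m≤n⇒m<n∨m≡n i≤j
    ... | inj₁ i<j  = <-trans (sumTo-strictMono i<j (≤-trans (n≤1+n j) j<1+d)) (sumTo-step (s≤s⁻¹ j<1+d))
    ... | inj₂ refl = sumTo-step (s≤s⁻¹ j<1+d)

    sumTo-mono : ∀ {i j} → i ≤ j → j ≤ suc d → s i ≤ s j
    sumTo-mono i≤j j≤1+d with m≤n⇒m<n∨m≡n i≤j
    ... | inj₁ i<j  = <⇒≤ (sumTo-strictMono i<j j≤1+d)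
    ... | inj₂ refl = ≤-refl

    sumTo-cancel-< : ∀ {i j} → i ≤ suc d → s i < s j → i < j
    sumTo-cancel-< {i} {j} i≤1+d si<sj with i <? j
    ... | yes i<j = i<j
    ... | no  i≮j = contradiction (sumTo-mono (≮⇒≥ i≮j) i≤1+d) (<⇒≱ si<sj)

    module Cycle (n : ℕ) .{{_ : NonZero n}} (n≡s[1+d] : n ≡ s (suc d)) where

      open Translates n

      sumTo<n : ∀ {i} → i ≤ d → s i < n
      sumTo<n i≤d = subst (_ <_) (sym n≡s[1+d]) (sumTo-strictMono (s≤s i≤d) ≤-refl)

      sumTo≤n : ∀ {i} → i ≤ suc d → s i ≤ n
      sumTo≤n i≤1+d = subst (_ ≤_) (sym n≡s[1+d]) (sumTo-mono i≤1+d ≤-refl)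

      vertex-sumTo : ∀ {i} → i ≤ suc d → Vertex 0 (s i)
      vertex-sumTo {i} i≤1+d with m≤n⇒m<n∨m≡n i≤1+d
      ... | inj₁ i<1+d = i , s≤s⁻¹ i<1+d , cong (_% n) (+-identityʳ (s i))
      ... | inj₂ refl  = 0 , z≤n , trans (sym (x+n≋x 0)) (cong (_% n) n≡s[1+d])

      vertex-index : ∀ {y} → Vertex 0 y → y < n → ∃[ i ] i ≤ d × s i ≡ y
      vertex-index (i , i≤d , e) y<n =
        i , i≤d , ≋⇒≡ (sumTo<n i≤d) y<n (subst (_≋ _) (+-identityʳ (s i)) e)

      next-vertex : ∀ {i y} → i ≤ d → Vertex 0 y → y < n → s i < y → s (suc i) ≤ y
      next-vertex i≤d v y<n si<y with vertex-index v y<n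
      ... | i′ , i′≤d , refl =
        sumTo-mono (sumTo-cancel-< (≤-trans i≤d (n≤1+n d)) si<y) (≤-trans i′≤d (n≤1+n d))

      -- shift: translation by s j preserves the vertex set, so it sends the vertex after s i to the
      -- vertex after s (i + j); inductively s (i + j) = s i + s j, whence a_i = a_{i+j}.
      period⇒periodic : ∀ {j} → j ≤ d → 0 < s j → IsPeriod (s j) → Periodic d a j
      period⇒periodic {j} j≤d 0<sj pj l l+j≤d = +-cancelˡ-≡ (s l + s j) _ _ (begin
          s l + s j + a l        ≡⟨ xy∙z≈xz∙y (s l) (s j) (a l) ⟩
          s (suc l) + s j        ≡⟨ shift (suc l) (s≤s l+j≤d) ⟨
          s (l + j) + a (l + j)  ≡⟨ cong (_+ a (l + j)) (shift l (≤-trans l+j≤d (n≤1+n d))) ⟩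
          s l + s j + a (l + j)  ∎)
        where
        open ≡-Reasoning
        shift : ∀ i → i + j ≤ suc d → s (i + j) ≡ s i + s j
        shift zero    _  = refl
        shift (suc i) le = ≤-antisym upper lower
          where
          ih : s (i + j) ≡ s i + s j
          ih = shift i (≤-trans (n≤1+n _) le)
          i+j≤d : i + j ≤ d
          i+j≤d = s≤s⁻¹ le
          i≤d : i ≤ d
          i≤d = ≤-trans (m≤m+n i j) i+j≤d
          upper : s (suc i + j) ≤ s (suc i) + s j
          upper with n ≤? s (suc i) + s j
          ... | yes n≤ = ≤-trans (sumTo≤n le) n≤
          ... | no  n≰ = next-vertex i+j≤d (period-forward pj (vertex-sumTo (s≤s i≤d))) (≰⇒> n≰)
                           (subst (_< s (suc i) + s j) (sym ih) (+-monoˡ-< (s j) (sumTo-step i≤d)))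
          sj≤ : s j ≤ s (suc i + j)
          sj≤ = ≤-trans (m≤n+m (s j) (s i)) (≤-trans (≤-reflexive (sym ih)) (<⇒≤ (sumTo-step i+j≤d)))
          w = s (suc i + j) ∸ s j
          w+sj≡ : w + s j ≡ s (suc i + j)
          w+sj≡ = m∸n+n≡m sj≤
          lower : s (suc i) + s j ≤ s (suc i + j)
          lower = subst (s (suc i) + s j ≤_) w+sj≡ (+-monoˡ-≤ (s j) (next-vertex i≤d
                    (period-backward pj (subst (Vertex 0) (sym w+sj≡) (vertex-sumTo le)))
                    (<-≤-trans (m<m+n w 0<sj) (subst (_≤ n) (sym w+sj≡) (sumTo≤n le)))
                    (+-cancelʳ-< (s j) (s i) w (subst₂ _<_ ih (sym w+sj≡) (sumTo-step i+j≤d)))))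

      remainder-period : ∀ {j} .{{_ : NonZero j}} → Periodic d a j → IsPeriod (s j) → IsPeriod (s (suc d % j))
      remainder-period {j} j-periodic pj = subst IsPeriod n∸qu≡sr (IsPeriod-∸ qu≤n (IsPeriod-* q pj))
        where
        q = suc d / j
        r = suc d % j
        qj+r≡1+d : q * j + r ≡ suc d
        qj+r≡1+d = trans (+-comm (q * j) r) (sym (m≡m%n+[m/n]*n (suc d) j))
        qj≤1+d : q * j ≤ suc d
        qj≤1+d = subst (q * j ≤_) qj+r≡1+d (m≤m+n _ r)
        n≡qu+sr : n ≡ q * s j + s r
        n≡qu+sr = begin
          n                  ≡⟨ n≡s[1+d] ⟩
          s (suc d)          ≡⟨ cong s qj+r≡1+d ⟨
          s (q * j + r)      ≡⟨ sumTo-periodic j-periodic q r (≤-reflexive qj+r≡1+d) ⟩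
          s (q * j) + s r    ≡⟨ cong (_+ s r) (sumTo-multiple j-periodic q qj≤1+d) ⟩
          q * s j + s r      ∎
          where open ≡-Reasoning
        qu≤n : q * s j ≤ n
        qu≤n = subst (_ ≤_) (sym n≡qu+sr) (m≤m+n _ _)
        n∸qu≡sr : n ∸ q * s j ≡ s r
        n∸qu≡sr = trans (cong (_∸ q * s j) n≡qu+sr) (m+n∸m≡n (q * s j) (s r))

      module Smallest (k : ℕ) (1≤k : 1 ≤ k) (k≤1+d : k ≤ suc d) (k∣1+d : k ∣ suc d)
                      (k-periodic : Periodic d a k) (k-minimal : ∀ k′ → Admissible d a k′ → k ≤ k′) where

        L : ℕ
        L = s k

        0<L : 0 < L
        0<L = sumTo-strictMono 1≤k k≤1+d

        instance
          L≢0 : NonZero L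
          L≢0 = >-nonZero 0<L

        L≤n : L ≤ n
        L≤n = sumTo≤n k≤1+d

        shift-by-multiple : ∀ {m m′} → k ∣ m → k ∣ m′ → m + m′ ≡ suc d →
                            ∀ {i} → i ≤ d → ∃[ i′ ] i′ ≤ d × s i′ ≋ s i + s m
        shift-by-multiple {m} {m′} k∣m k∣m′ m+m′≡1+d {i} i≤d with i + m ≤? d
        ... | yes i+m≤d = m + i , m+i≤d , cong (_% n) (trans
              (sumTo-+-multiple k-periodic i k∣m (≤-trans m+i≤d (n≤1+n d))) (+-comm (s m) (s i)))
          where
          m+i≤d : m + i ≤ d
          m+i≤d = subst (_≤ d) (+-comm i m) i+m≤d
        ... | no  i+m≰d = i ∸ m′ , ≤-trans (m∸n≤m i m′) i≤d , sym wrap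
          where
          open ≡-Reasoning
          m′≤i : m′ ≤ i
          m′≤i = +-cancelʳ-≤ m m′ i
                   (subst (_≤ i + m) (sym (trans (+-comm m′ m) m+m′≡1+d)) (≰⇒> i+m≰d))
          i′ = i ∸ m′
          m′+i′≡i : m′ + i′ ≡ i
          m′+i′≡i = m+[n∸m]≡n m′≤i
          n≡ : n ≡ s m + s m′
          n≡ = trans n≡s[1+d] (trans (cong s (sym m+m′≡1+d))
                 (sumTo-+-multiple k-periodic m′ k∣m (≤-reflexive m+m′≡1+d)))
          m′+i′≤1+d : m′ + i′ ≤ suc d
          m′+i′≤1+d = ≤-trans (≤-reflexive m′+i′≡i) (≤-trans i≤d (n≤1+n d))
          wrap : s i + s m ≋ s i′
          wrap = begin
            (s i + s m) % n          ≡⟨ cong (λ l → (s l + s m) % n) m′+i′≡i ⟨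
            (s (m′ + i′) + s m) % n  ≡⟨ cong (λ z → (z + s m) % n) (sumTo-+-multiple k-periodic i′ k∣m′ m′+i′≤1+d) ⟩
            (s m′ + s i′ + s m) % n  ≡⟨ cong (_% n) (xy∙z≈y∙zx (s m′) (s i′) (s m)) ⟩
            (s i′ + (s m + s m′)) % n ≡⟨ cong (λ z → (s i′ + z) % n) n≡ ⟨
            (s i′ + n) % n           ≡⟨ x+n≋x (s i′) ⟩
            s i′ % n                 ∎

        -- Since s D + L = n, translation by s D undoes translation by L modulo n.
        L-period : IsPeriod L
        L-period y = mk⇔ to from
          where
          D = suc d ∸ k
          k+D≡1+d : k + D ≡ suc d
          k+D≡1+d = m+[n∸m]≡n k≤1+d
          D+k≡1+d : D + k ≡ suc d
          D+k≡1+d = m∸n+n≡m k≤1+d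
          k∣D : k ∣ D
          k∣D = ∣m+n∣m⇒∣n (subst (k ∣_) (sym k+D≡1+d) k∣1+d) ∣-refl
          n≡sD+L : n ≡ s D + L
          n≡sD+L = trans n≡s[1+d] (trans (cong s (sym D+k≡1+d))
                     (sumTo-+-multiple k-periodic k k∣D (≤-reflexive D+k≡1+d)))
          to : Vertex 0 y → Vertex L y
          to (i , i≤d , e) with i′ , i′≤d , e′ ← shift-by-multiple k∣D ∣-refl D+k≡1+d i≤d =
            i′ , i′≤d , (begin
              (s i′ + L) % n       ≡⟨ ≋-+ {y = L} {L} e′ refl ⟩
              (s i + s D + L) % n  ≡⟨ cong (_% n) (trans (+-assoc (s i) (s D) L) (cong (s i +_) (sym n≡sD+L))) ⟩
              (s i + n) % n        ≡⟨ x+n≋x (s i) ⟩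
              s i % n              ≡⟨ subst (_≋ y) (+-identityʳ (s i)) e ⟩
              y % n                ∎)
            where open ≡-Reasoning
          from : Vertex L y → Vertex 0 y
          from (i , i≤d , e) with i′ , i′≤d , e′ ← shift-by-multiple ∣-refl k∣D k+D≡1+d i≤d =
            i′ , i′≤d , subst (_≋ y) (sym (+-identityʳ (s i′))) (trans e′ e)

        -- Strong induction on u = s j: a is j-periodic, and r = (d+1) mod j either vanishes, making j
        -- admissible, or yields the smaller period s r.
        L≤period : ∀ {u} → 0 < u → IsPeriod u → L ≤ u
        L≤period {u} = <-rec (λ u → 0 < u → IsPeriod u → L ≤ u) step u
          where
          step : ∀ u → (∀ {v} → v < u → 0 < v → IsPeriod v → L ≤ v) → 0 < u → IsPeriod u → L ≤ u
          step u rec 0<u pu with n ≤? u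
          ... | yes n≤u = ≤-trans L≤n n≤u
          ... | no  n≰u with j , j≤d , refl ← vertex-index (period-forward pu (vertex-sumTo z≤n)) (≰⇒> n≰u) =
            L≤s[j]
            where
            instance
              j≢0 : NonZero j
              j≢0 = >-nonZero (0<sumTo⇒0<index 0<u)
            j≤1+d : j ≤ suc d
            j≤1+d = ≤-trans j≤d (n≤1+n d)
            j-periodic : Periodic d a j
            j-periodic = period⇒periodic j≤d 0<u pu
            L≤s[j] : L ≤ s j
            L≤s[j] with suc d % j in r≡
            ... | zero   =
              sumTo-mono (k-minimal j (>-nonZero⁻¹ j , j≤1+d , m%n≡0⇒n∣m (suc d) j r≡ , j-periodic)) j≤1+d
            ... | suc r′ = ≤-trans (rec sr<sj (sumTo-strictMono z<s (≤-trans (<⇒≤ 1+r′<j) j≤1+d))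
                                        (subst (λ r → IsPeriod (s r)) r≡ (remainder-period j-periodic pu)))
                                   (<⇒≤ sr<sj)
              where
              1+r′<j : suc r′ < j
              1+r′<j = subst (_< j) r≡ (m%n<n (suc d) j)
              sr<sj : s (suc r′) < s j
              sr<sj = sumTo-strictMono 1+r′<j j≤1+d

        translate-mod : ∀ t → tr t ≡ tr (t % L)
        translate-mod t = Agree⇒translate-≡ (Agree-sym (subst (Agree (t % L)) (sym (m≡m%n+[m/n]*n t L))
                            (IsPeriod⇒Agree (t % L) (IsPeriod-* (t / L) L-period))))

        translate-injective : ∀ {t t′} → t < t′ → t′ < L → tr t ≢ tr t′
        translate-injective {t} {t′} t<t′ t′<L eq = <⇒≱ u<L (L≤period (m<n⇒0<n∸m t<t′) u-period)
          where
          u = t′ ∸ t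
          u<L : u < L
          u<L = ≤-<-trans (m∸n≤m t′ t) t′<L
          u-period : IsPeriod u
          u-period = Agree⇒IsPeriod (translate-≡⇒Agree (trans eq (cong tr (sym (m+[n∸m]≡n (<⇒≤ t<t′))))))

        cycleLength≡L : cycleLength n d a ≡ L
        cycleLength≡L = trans
          (length-deduplicate (≡-dec _≟ᵇ_) (orbitList n d a) (applyUpTo tr L)
             (applyUpTo⁺₁ tr L translate-injective) (mk⇔ to from))
          (length-applyUpTo tr L)
          where
          to : ∀ {z} → z ∈ orbitList n d a → z ∈ applyUpTo tr L
          to h with t , _ , refl ← ∈-map⁻ tr h =
            subst (_∈ applyUpTo tr L) (sym (translate-mod t)) (∈-applyUpTo⁺ tr (m%n<n t L))
          from : ∀ {z} → z ∈ applyUpTo tr L → z ∈ orbitList n d a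
          from h with i , i<L , refl ← ∈-applyUpTo⁻ tr h = ∈-map⁺ tr (∈-upTo⁺ (<-≤-trans i<L L≤n))

        L≡n*k/[1+d] : L ≡ (n * k) / suc d
        L≡n*k/[1+d] = sym (begin
          n * k / suc d        ≡⟨ cong (λ m → m * k / suc d) (trans n≡s[1+d] (cong s 1+d≡q*k)) ⟩
          s (q * k) * k / suc d ≡⟨ cong (λ m → m * k / suc d) (sumTo-multiple k-periodic q qk≤1+d) ⟩
          q * L * k / suc d    ≡⟨ cong (_/ suc d) (trans (cong (_* k) (*-comm q L)) (*-assoc L q k)) ⟩
          L * (q * k) / suc d  ≡⟨ cong (λ m → L * m / suc d) 1+d≡q*k ⟨
          L * suc d / suc d    ≡⟨ m*n/n≡m L (suc d) ⟩
          L                    ∎)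
          where
          open ≡-Reasoning
          q = _∣_.quotient k∣1+d
          1+d≡q*k : suc d ≡ q * k
          1+d≡q*k = _∣_.equality k∣1+d
          qk≤1+d : q * k ≤ suc d
          qk≤1+d = ≤-reflexive (sym 1+d≡q*k)

lemma3p2 : (d n : ℕ) .{{_ : NonZero n}} (a : ℕ → ℕ) →
           (∀ i → i ≤ d → 1 ≤ a i) →
           n ≡ sumTo (suc d) a →
           (k : ℕ) → IsSmallestAdmissible d a k →
           (cycleLength n d a ≡ sumTo k a) × (sumTo k a ≡ (n * k) / suc d)
lemma3p2 d n a pos n≡s[1+d] k ((1≤k , k≤1+d , k∣1+d , k-periodic) , k-minimal) =
  cycleLength≡L , L≡n*k/[1+d]
  where
  open DifferenceCycle d a
  open Cycle pos n n≡s[1+d]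
  open Smallest k 1≤k k≤1+d k∣1+d k-periodic k-minimal
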